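{- Let $\Sigma$ be a finite alphabet and let $w\in\Sigma^*$ be a parameterized square. Then there exists $\pi\in S_\Sigma$ such that $h_\pi(w)$ is an ordinary square.
   Context: Let $\sigma=|\Sigma|$. A parameterized square is a word $uv$ with $|u|=|v|$ and a bijection $f:\mathrm{Alph}(u)\to\mathrm{Alph}(v)$ ($\mathrm{Alph}$ = set of letters occurring) with $v[t]=f(u[t])$ for all $t$. An ordinary square is a word of the form $xx$. $S_\Sigma$ is the set of permutations of $\Sigma$, viewed as words of length $\sigma$ in which each letter of $\Sigma$ occurs exactly once. For $x\in\Sigma^*$ and $a$ occurring in $x$, $\mathrm{ind}_x(a)$ is the number of distinct letters occurring after the last occurrence of $a$ in $x$. For $\pi\in S_\Sigma$ and $w\in\Sigma^*$, $h_\pi(w)$ is the word $z\in\{0,\ldots,\sigma-1\}^{|w|}$ with $z[t]=\mathrm{ind}_{\pi w[1..t-1]}(w[t])$ for $t=1,\ldots,|w|$. -}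

module Defs where

open import Data.Nat using (ℕ)
open import Data.Fin using (Fin)
open import Data.Fin.Properties using (_≟_)
open import Data.List using (List; []; _∷_; _++_; [_]; length; deduplicate; filter; map)
open import Data.List.Membership.Propositional using (_∈_)
open import Data.Product using (Σ; ∃; _×_)
open import Relation.Nullary using (yes; no)
open import Relation.Binary.PropositionalEquality using (_≡_)
import Data.List.Membership.DecPropositional as DecMem

Word : ℕ → Set
Word σ = List (Fin σ)

-- π ∈ S_Σ : a word in which each letter of Σ occurs exactly once.
IsPerm : {σ : ℕ} → Word σ → Set
IsPerm {σ} π = (a : Fin σ) → length (filter (a ≟_) π) ≡ 1

-- the suffix of x after the last occurrence of a (empty if a does not occur)
afterLast : {σ : ℕ} → Fin σ → Word σ → Word σ
afterLast a [] = []
afterLast {σ} a (b ∷ xs) with DecMem._∈?_ (_≟_ {n = σ}) a xs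
... | yes _ = afterLast a xs
... | no _ with a ≟ b
...   | yes _ = xs
...   | no _ = []

ind : {σ : ℕ} → Word σ → Fin σ → ℕ
ind x a = length (deduplicate _≟_ (afterLast a x))

hGo : {σ : ℕ} → Word σ → Word σ → List ℕ
hGo x [] = []
hGo x (c ∷ w) = ind x c ∷ hGo (x ++ [ c ]) w

h : {σ : ℕ} → Word σ → Word σ → List ℕ
h π w = hGo π w

IsSquare : {A : Set} → List A → Set
IsSquare {A} z = Σ (List A) λ y → z ≡ y ++ y

-- parameterized square: w = u v, |u| = |v|, and a bijection f : Alph(u) → Alph(v)
-- with v[t] = f(u[t]).  f is given as a map on Σ whose restriction to Alph(u)
-- is injective, maps into Alph(v) and is onto Alph(v).
IsParamSquare : {σ : ℕ} → Word σ → Set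
IsParamSquare {σ} w =
  Σ (Word σ) λ u → Σ (Word σ) λ v → Σ (Fin σ → Fin σ) λ f →
    (w ≡ u ++ v) × (length u ≡ length v) ×
    ((a : Fin σ) → a ∈ u → f a ∈ v) ×
    ((a b : Fin σ) → a ∈ u → b ∈ u → f a ≡ f b → a ≡ b) ×
    ((b : Fin σ) → b ∈ v → ∃ λ a → a ∈ u × f a ≡ b) ×
    (v ≡ map f u)

module Submission where

-- Reading a word with h is move-to-front coding: ind x a is the number of letters after a in
-- keepLast x, the letters of x ordered by their last occurrence. So h x p depends only on keepLast x, and is
-- unchanged when x and p are renamed by the same bijection g. Extend f to a permutation g of Σ
-- fixing every letter outside Alph(u) ∪ Alph(v); it suffices to find a permutation π with
-- keepLast (π u) = g π, for then h (π u) v = h (g π) (g u) = h π u. Take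
-- π = keepLast (Σ g⁻²(u) g⁻¹(u)): the letters of g⁻²(u) all recur in g⁻¹(u) u, and g fixes
-- the letters not in g⁻¹(u) u, so
-- keepLast (π u) = keepLast (Σ g⁻¹(u) u) = keepLast (g(Σ) g⁻¹(u) u) = g π.

open import Defs
open import Data.Nat using (ℕ; suc)
open import Data.Nat.Properties using (suc-injective)
open import Data.Fin using (Fin)
import Data.Fin.Properties as Fin
open import Data.List using (List; []; _∷_; _++_; [_]; length; deduplicate; filter; map; allFin)
open import Data.List.Properties
  using (++-assoc; ++-identityʳ; length-map; map-++; map-∘; map-cong; map-id; map-cong-local;
         filter-accept; filter-reject; filter-none; filter-≐)
open import Data.List.Membership.Propositional using (_∈_; _∉_)
open import Data.List.Membership.Propositional.Properties
  using (∈-map⁺; ∈-map⁻; ∈-++⁺ˡ; ∈-++⁺ʳ; ∈-++⁻; ∈-deduplicate⁺; ∈-deduplicate⁻;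
         ∈-allFin; ∈-filter⁺; ∈-filter⁻)
open import Data.List.Membership.Propositional.Properties.WithK using (unique∧set⇒bag)
import Data.List.Membership.DecPropositional as DecMembership
open import Data.List.Relation.Binary.BagAndSetEquality using (∼bag⇒↭)
open import Data.List.Relation.Binary.Permutation.Propositional.Properties using (↭-length)
import Data.List.Relation.Unary.All as All
open import Data.List.Relation.Unary.All.Properties using (¬Any⇒All¬) renaming (map⁺ to All-map⁺)
open import Data.List.Relation.Unary.Any using (here; there; tail)
open import Data.List.Relation.Unary.Unique.Propositional using (Unique; []; _∷_)
import Data.List.Relation.Unary.Unique.Propositional.Properties as Unique
open import Data.List.Relation.Unary.Unique.DecPropositional.Properties using (deduplicate-!)
open import Data.Product using (Σ; _×_; _,_; proj₁; proj₂)
open import Data.Sum using (inj₁; inj₂; [_,_]′)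
open import Function using (_∘_; _⇔_; mk⇔; Injective; Equivalence)
open import Relation.Binary.Definitions using (DecidableEquality)
open import Relation.Nullary using (Dec; yes; no; ¬?; contradiction)
open import Relation.Binary.PropositionalEquality hiding ([_])
open ≡-Reasoning

length-unique : {A : Set} {xs ys : List A} → Unique xs → Unique ys →
                (∀ {z} → z ∈ xs ⇔ z ∈ ys) → length xs ≡ length ys
length-unique xs! ys! xs⇔ys = ↭-length (∼bag⇒↭ (unique∧set⇒bag xs! ys! xs⇔ys))

module ListsWithDecEq {A : Set} (_≟_ : DecidableEquality A) where

  open DecMembership _≟_ using (_∈?_)

  _∉?_ : (a : A) (xs : List A) → Dec (a ∉ xs)
  a ∉? xs = ¬? (a ∈? xs)

  ∈-map⁻-injective : {g : A → A} → Injective _≡_ _≡_ g → ∀ {a} xs → g a ∈ map g xs → a ∈ xs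
  ∈-map⁻-injective g-inj xs ga∈ with ∈-map⁻ _ ga∈
  ... | b , b∈xs , ga≡gb = subst (_∈ xs) (sym (g-inj ga≡gb)) b∈xs

  card : List A → ℕ
  card xs = length (deduplicate _≟_ xs)

  card-cong : ∀ {xs ys} → (∀ {z} → z ∈ xs ⇔ z ∈ ys) → card xs ≡ card ys
  card-cong {xs} {ys} xs⇔ys = length-unique (deduplicate-! _≟_ xs) (deduplicate-! _≟_ ys)
    (mk⇔ (∈-deduplicate⁺ _≟_ ∘ Equivalence.to xs⇔ys ∘ ∈-deduplicate⁻ _≟_ xs)
         (∈-deduplicate⁺ _≟_ ∘ Equivalence.from xs⇔ys ∘ ∈-deduplicate⁻ _≟_ ys))

  card-map : {g : A → A} → Injective _≡_ _≡_ g → ∀ xs → card (map g xs) ≡ card xs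
  card-map {g} g-inj xs = trans
    (length-unique (deduplicate-! _≟_ (map g xs)) (Unique.map⁺ g-inj (deduplicate-! _≟_ xs))
      (mk⇔ to from))
    (length-map g (deduplicate _≟_ xs))
    where
    to : ∀ {z} → z ∈ deduplicate _≟_ (map g xs) → z ∈ map g (deduplicate _≟_ xs)
    to z∈ with ∈-map⁻ g (∈-deduplicate⁻ _≟_ (map g xs) z∈)
    ... | a , a∈xs , refl = ∈-map⁺ g (∈-deduplicate⁺ _≟_ a∈xs)
    from : ∀ {z} → z ∈ map g (deduplicate _≟_ xs) → z ∈ deduplicate _≟_ (map g xs)
    from z∈ with ∈-map⁻ g z∈
    ... | a , a∈ , refl = ∈-deduplicate⁺ _≟_ (∈-map⁺ g (∈-deduplicate⁻ _≟_ xs a∈))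

  keepLast : List A → List A
  keepLast []      = []
  keepLast (c ∷ x) with c ∈? x
  ... | yes _ = keepLast x
  ... | no  _ = c ∷ keepLast x

  ∈-keepLast⁻ : ∀ x {a} → a ∈ keepLast x → a ∈ x
  ∈-keepLast⁻ (c ∷ x) a∈ with c ∈? x
  ... | yes _ = there (∈-keepLast⁻ x a∈)
  ∈-keepLast⁻ (c ∷ x) (here a≡c)  | no _ = here a≡c
  ∈-keepLast⁻ (c ∷ x) (there a∈) | no _ = there (∈-keepLast⁻ x a∈)

  ∈-keepLast⁺ : ∀ x {a} → a ∈ x → a ∈ keepLast x
  ∈-keepLast⁺ (c ∷ x) a∈ with c ∈? x
  ∈-keepLast⁺ (c ∷ x) (here refl) | yes c∈x = ∈-keepLast⁺ x c∈x
  ∈-keepLast⁺ (c ∷ x) (there a∈)  | yes _   = ∈-keepLast⁺ x a∈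
  ∈-keepLast⁺ (c ∷ x) (here a≡c)  | no _    = here a≡c
  ∈-keepLast⁺ (c ∷ x) (there a∈)  | no _    = there (∈-keepLast⁺ x a∈)

  keepLast-idem : ∀ x → keepLast (keepLast x) ≡ keepLast x
  keepLast-idem []      = refl
  keepLast-idem (c ∷ x) with c ∈? x
  ... | yes _ = keepLast-idem x
  ... | no c∉x with c ∈? keepLast x
  ...   | yes c∈ = contradiction (∈-keepLast⁻ x c∈) c∉x
  ...   | no _   = cong (c ∷_) (keepLast-idem x)

  count-keepLast : ∀ x {a} → a ∈ x → length (filter (a ≟_) (keepLast x)) ≡ 1
  count-keepLast (c ∷ x) a∈ with c ∈? x
  count-keepLast (c ∷ x) (here refl) | yes c∈x = count-keepLast x c∈x
  count-keepLast (c ∷ x) (there a∈)  | yes _   = count-keepLast x a∈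
  count-keepLast (c ∷ x) {a} a∈      | no c∉x with a ≟ c
  ... | yes refl = cong (suc ∘ length)
                     (filter-none (a ≟_) (¬Any⇒All¬ (keepLast x) (c∉x ∘ ∈-keepLast⁻ x)))
  ... | no a≢c   = count-keepLast x (tail a≢c a∈)

  keepLast-++ : ∀ x y → keepLast (x ++ y) ≡ filter (_∉? y) (keepLast x) ++ keepLast y
  keepLast-++ []      y = refl
  keepLast-++ (c ∷ x) y with c ∈? (x ++ y) | c ∈? x
  ... | yes _    | yes _   = keepLast-++ x y
  ... | yes c∈xy | no c∉x  = trans (keepLast-++ x y) (cong (_++ keepLast y)
        (sym (filter-reject (_∉? y) (λ c∉y → [ c∉x , c∉y ]′ (∈-++⁻ x c∈xy)))))
  ... | no c∉xy  | yes c∈x = contradiction (∈-++⁺ˡ c∈x) c∉xy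
  ... | no c∉xy  | no _    = trans (cong (c ∷_) (keepLast-++ x y)) (cong (_++ keepLast y)
        (sym (filter-accept (_∉? y) (c∉xy ∘ ∈-++⁺ʳ x))))

  keepLast-++-congˡ : ∀ x y z → keepLast x ≡ keepLast y → keepLast (x ++ z) ≡ keepLast (y ++ z)
  keepLast-++-congˡ x y z eq = begin
    keepLast (x ++ z)                          ≡⟨ keepLast-++ x z ⟩
    filter (_∉? z) (keepLast x) ++ keepLast z  ≡⟨ cong (λ s → filter (_∉? z) s ++ keepLast z) eq ⟩
    filter (_∉? z) (keepLast y) ++ keepLast z  ≡⟨ keepLast-++ y z ⟨
    keepLast (y ++ z)                          ∎

  keepLast-++-absorb : ∀ x {y} z → (∀ {a} → a ∈ y → a ∈ z) →
                       keepLast (x ++ y ++ z) ≡ keepLast (x ++ z)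
  keepLast-++-absorb x {y} z y⊆z = begin
    keepLast (x ++ y ++ z)
      ≡⟨ keepLast-++ x (y ++ z) ⟩
    filter (_∉? (y ++ z)) (keepLast x) ++ keepLast (y ++ z)
      ≡⟨ cong₂ _++_ (filter-≐ (_∉? (y ++ z)) (_∉? z) (∉yz⇒∉z , ∉z⇒∉yz) (keepLast x))
                    (keepLast-++ y z) ⟩
    filter (_∉? z) (keepLast x) ++ filter (_∉? z) (keepLast y) ++ keepLast z
      ≡⟨ cong (λ s → filter (_∉? z) (keepLast x) ++ s ++ keepLast z)
              (filter-none (_∉? z) (All.tabulate (λ a∈ a∉z → a∉z (y⊆z (∈-keepLast⁻ y a∈))))) ⟩
    filter (_∉? z) (keepLast x) ++ keepLast z
      ≡⟨ keepLast-++ x z ⟨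
    keepLast (x ++ z) ∎
    where
    ∉yz⇒∉z : ∀ {a} → a ∉ y ++ z → a ∉ z
    ∉yz⇒∉z a∉yz = a∉yz ∘ ∈-++⁺ʳ y
    ∉z⇒∉yz : ∀ {a} → a ∉ z → a ∉ y ++ z
    ∉z⇒∉yz a∉z a∈yz = [ a∉z ∘ y⊆z , a∉z ]′ (∈-++⁻ y a∈yz)

  keepLast-map : {g : A → A} → Injective _≡_ _≡_ g → ∀ x → keepLast (map g x) ≡ map g (keepLast x)
  keepLast-map g-inj []      = refl
  keepLast-map {g} g-inj (c ∷ x) with g c ∈? map g x | c ∈? x
  ... | yes _   | yes _   = keepLast-map g-inj x
  ... | yes gc∈ | no c∉x  = contradiction (∈-map⁻-injective g-inj x gc∈) c∉x
  ... | no gc∉  | yes c∈x = contradiction (∈-map⁺ g c∈x) gc∉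
  ... | no _    | no _    = cong (g c ∷_) (keepLast-map g-inj x)

  filter-∉-map : {g : A → A} {z : List A} → (∀ {a} → a ∈ z → g a ∈ z) → (∀ {a} → a ∉ z → g a ≡ a) →
                 ∀ xs → filter (_∉? z) (map g xs) ≡ filter (_∉? z) xs
  filter-∉-map g-in g-out [] = refl
  filter-∉-map {g} {z} g-in g-out (c ∷ xs) = by-cases (c ∈? z)
    where
    by-cases : Dec (c ∈ z) → filter (_∉? z) (map g (c ∷ xs)) ≡ filter (_∉? z) (c ∷ xs)
    by-cases (yes c∈z) = begin
      filter (_∉? z) (g c ∷ map g xs) ≡⟨ filter-reject (_∉? z) (λ gc∉z → gc∉z (g-in c∈z)) ⟩
      filter (_∉? z) (map g xs)       ≡⟨ filter-∉-map g-in g-out xs ⟩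
      filter (_∉? z) xs               ≡⟨ filter-reject (_∉? z) (λ c∉z → c∉z c∈z) ⟨
      filter (_∉? z) (c ∷ xs)         ∎
    by-cases (no c∉z) = begin
      filter (_∉? z) (g c ∷ map g xs) ≡⟨ cong (λ b → filter (_∉? z) (b ∷ map g xs)) (g-out c∉z) ⟩
      filter (_∉? z) (c ∷ map g xs)   ≡⟨ filter-accept (_∉? z) c∉z ⟩
      c ∷ filter (_∉? z) (map g xs)   ≡⟨ cong (c ∷_) (filter-∉-map g-in g-out xs) ⟩
      c ∷ filter (_∉? z) xs           ≡⟨ filter-accept (_∉? z) c∉z ⟨
      filter (_∉? z) (c ∷ xs)         ∎

  keepLast-map-++ : {g : A → A} {z : List A} → Injective _≡_ _≡_ g →
                    (∀ {a} → a ∈ z → g a ∈ z) → (∀ {a} → a ∉ z → g a ≡ a) →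
                    ∀ x → keepLast (map g x ++ z) ≡ keepLast (x ++ z)
  keepLast-map-++ {g} {z} g-inj g-in g-out x = begin
    keepLast (map g x ++ z)                           ≡⟨ keepLast-++ (map g x) z ⟩
    filter (_∉? z) (keepLast (map g x)) ++ keepLast z ≡⟨ cong (λ s → filter (_∉? z) s ++ keepLast z)
                                                           (keepLast-map g-inj x) ⟩
    filter (_∉? z) (map g (keepLast x)) ++ keepLast z ≡⟨ cong (_++ keepLast z)
                                                           (filter-∉-map g-in g-out (keepLast x)) ⟩
    filter (_∉? z) (keepLast x) ++ keepLast z         ≡⟨ keepLast-++ x z ⟨
    keepLast (x ++ z)                                 ∎

  zipMap : List A → List A → A → A
  zipMap (x ∷ xs) (y ∷ ys) a with a ≟ x
  ... | yes _ = y
  ... | no  _ = zipMap xs ys a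
  zipMap _ _ a = a

  zipMap-∉ : ∀ xs ys {a} → a ∉ xs → zipMap xs ys a ≡ a
  zipMap-∉ []       ys       a∉ = refl
  zipMap-∉ (x ∷ xs) []       a∉ = refl
  zipMap-∉ (x ∷ xs) (y ∷ ys) {a} a∉ with a ≟ x
  ... | yes a≡x = contradiction (here a≡x) a∉
  ... | no _    = zipMap-∉ xs ys (a∉ ∘ there)

  zipMap-∈ : ∀ xs ys {a} → length xs ≡ length ys → a ∈ xs → zipMap xs ys a ∈ ys
  zipMap-∈ (x ∷ xs) (y ∷ ys) {a} eq a∈ with a ≟ x
  ... | yes _   = here refl
  ... | no a≢x  = there (zipMap-∈ xs ys (suc-injective eq) (tail a≢x a∈))

  zipMap-map : ∀ (f : A → A) xs xs′ ys′ {a} → a ∈ xs → zipMap (xs ++ xs′) (map f xs ++ ys′) a ≡ f a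
  zipMap-map f (x ∷ xs) xs′ ys′ {a} a∈ with a ≟ x
  ... | yes refl = refl
  ... | no a≢x   = zipMap-map f xs xs′ ys′ (tail a≢x a∈)

  zipMap-inverse-∈ : ∀ xs ys {a} → length xs ≡ length ys → Unique ys → a ∈ xs →
                     zipMap ys xs (zipMap xs ys a) ≡ a
  zipMap-inverse-∈ (x ∷ xs) (y ∷ ys) {a} eq (y∉ys ∷ ys!) a∈ with a ≟ x
  ... | yes a≡x with y ≟ y
  ...   | yes _   = sym a≡x
  ...   | no y≢y  = contradiction refl y≢y
  zipMap-inverse-∈ (x ∷ xs) (y ∷ ys) {a} eq (y∉ys ∷ ys!) a∈ | no a≢x
    with zipMap xs ys a ≟ y
  ... | yes b≡y = contradiction (sym b≡y)
                    (All.lookup y∉ys (zipMap-∈ xs ys (suc-injective eq) (tail a≢x a∈)))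
  ... | no _    = zipMap-inverse-∈ xs ys (suc-injective eq) ys! (tail a≢x a∈)

  zipMap-inverse : ∀ {xs ys} → Unique xs → Unique ys → (∀ {z} → z ∈ xs ⇔ z ∈ ys) →
                   ∀ a → zipMap ys xs (zipMap xs ys a) ≡ a
  zipMap-inverse {xs} {ys} xs! ys! xs⇔ys a with a ∈? xs
  ... | yes a∈ = zipMap-inverse-∈ xs ys (length-unique xs! ys! xs⇔ys) ys! a∈
  ... | no a∉  = begin
    zipMap ys xs (zipMap xs ys a) ≡⟨ cong (zipMap ys xs) (zipMap-∉ xs ys a∉) ⟩
    zipMap ys xs a                ≡⟨ zipMap-∉ ys xs (a∉ ∘ Equivalence.from xs⇔ys) ⟩
    a                             ∎

  map⁺-injectiveOn : {f : A → A} {xs : List A} → (∀ a b → a ∈ xs → b ∈ xs → f a ≡ f b → a ≡ b) →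
                     Unique xs → Unique (map f xs)
  map⁺-injectiveOn f-inj []             = []
  map⁺-injectiveOn {xs = x ∷ xs} f-inj (x∉xs ∷ xs!) =
    All-map⁺ (All.tabulate λ y∈ fx≡fy → All.lookup x∉xs y∈ (f-inj _ _ (here refl) (there y∈) fx≡fy))
    ∷ map⁺-injectiveOn (λ a b a∈ b∈ → f-inj a b (there a∈) (there b∈)) xs!

  record Extension (f : A → A) (u : List A) : Set where
    field
      g g⁻¹    : A → A
      inverseˡ : ∀ a → g (g⁻¹ a) ≡ a
      inverseʳ : ∀ a → g⁻¹ (g a) ≡ a
      agrees   : ∀ {a} → a ∈ u → g a ≡ f a
      fixes    : ∀ {a} → a ∉ u → a ∉ map f u → g a ≡ a

  -- Pair the letters of u with their images, and the letters of map f u outside u with the letters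
  -- of u outside map f u; both sides then list the same set without repetition.
  extend : (f : A → A) (u : List A) → (∀ a b → a ∈ u → b ∈ u → f a ≡ f b → a ≡ b) → Extension f u
  extend f u f-inj = record
    { g        = zipMap xs ys
    ; g⁻¹      = zipMap ys xs
    ; inverseˡ = zipMap-inverse ys! xs! (mk⇔ ys⊆xs xs⊆ys)
    ; inverseʳ = zipMap-inverse xs! ys! (mk⇔ xs⊆ys ys⊆xs)
    ; agrees   = zipMap-map f U D D′ ∘ ∈-deduplicate⁺ _≟_
    ; fixes    = λ a∉u a∉v → zipMap-∉ xs ys λ a∈xs →
                   [ a∉u ∘ ∈-deduplicate⁻ _≟_ u , a∉v ∘ ∈-D⁻ ]′ (∈-++⁻ U a∈xs)
    }
    where
    v U D D′ xs ys : List A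
    v  = map f u
    U  = deduplicate _≟_ u
    D  = filter (_∉? u) (deduplicate _≟_ v)
    D′ = filter (_∉? v) U
    xs = U ++ D
    ys = map f U ++ D′

    ∈-D⁻ : ∀ {a} → a ∈ D → a ∈ v
    ∈-D⁻ = ∈-deduplicate⁻ _≟_ v ∘ proj₁ ∘ ∈-filter⁻ (_∉? u) {xs = deduplicate _≟_ v}

    v⊆fU : ∀ {a} → a ∈ v → a ∈ map f U
    v⊆fU a∈v with ∈-map⁻ f a∈v
    ... | c , c∈u , refl = ∈-map⁺ f (∈-deduplicate⁺ _≟_ c∈u)

    fU⊆v : ∀ {a} → a ∈ map f U → a ∈ v
    fU⊆v a∈ with ∈-map⁻ f a∈
    ... | c , c∈U , refl = ∈-map⁺ f (∈-deduplicate⁻ _≟_ u c∈U)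

    xs⊆ys : ∀ {a} → a ∈ xs → a ∈ ys
    xs⊆ys {a} a∈xs with ∈-++⁻ U a∈xs
    ... | inj₂ a∈D = ∈-++⁺ˡ (v⊆fU (∈-D⁻ a∈D))
    ... | inj₁ a∈U with a ∈? v
    ...   | yes a∈v = ∈-++⁺ˡ (v⊆fU a∈v)
    ...   | no a∉v  = ∈-++⁺ʳ (map f U) (∈-filter⁺ (_∉? v) a∈U a∉v)

    ys⊆xs : ∀ {a} → a ∈ ys → a ∈ xs
    ys⊆xs {a} a∈ys with ∈-++⁻ (map f U) a∈ys
    ... | inj₂ a∈D′ = ∈-++⁺ˡ (proj₁ (∈-filter⁻ (_∉? v) {xs = U} a∈D′))
    ... | inj₁ a∈fU with a ∈? u
    ...   | yes a∈u = ∈-++⁺ˡ (∈-deduplicate⁺ _≟_ a∈u)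
    ...   | no a∉u  = ∈-++⁺ʳ U (∈-filter⁺ (_∉? u) (∈-deduplicate⁺ _≟_ (fU⊆v a∈fU)) a∉u)

    U! : Unique U
    U! = deduplicate-! _≟_ u

    xs! : Unique xs
    xs! = Unique.++⁺ U! (Unique.filter⁺ (_∉? u) (deduplicate-! _≟_ v))
            λ (a∈U , a∈D) → proj₂ (∈-filter⁻ (_∉? u) {xs = deduplicate _≟_ v} a∈D)
                                  (∈-deduplicate⁻ _≟_ u a∈U)

    ys! : Unique ys
    ys! = Unique.++⁺ (map⁺-injectiveOn (λ a b a∈ b∈ → f-inj a b (∈-deduplicate⁻ _≟_ u a∈)
                                                                   (∈-deduplicate⁻ _≟_ u b∈)) U!)
                     (Unique.filter⁺ (_∉? v) U!)
            λ (a∈fU , a∈D′) → proj₂ (∈-filter⁻ (_∉? v) {xs = U} a∈D′) (fU⊆v a∈fU)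

  module ExtensionProperties {f : A → A} {u : List A} (e : Extension f u) where

    open Extension e

    g-injective : Injective _≡_ _≡_ g
    g-injective {a} {b} ga≡gb = begin
      a         ≡⟨ inverseʳ a ⟨
      g⁻¹ (g a) ≡⟨ cong g⁻¹ ga≡gb ⟩
      g⁻¹ (g b) ≡⟨ inverseʳ b ⟩
      b         ∎

    map-inverseˡ : ∀ ys → map g (map g⁻¹ ys) ≡ ys
    map-inverseˡ ys = begin
      map g (map g⁻¹ ys) ≡⟨ map-∘ ys ⟨
      map (g ∘ g⁻¹) ys   ≡⟨ map-cong inverseˡ ys ⟩
      map (λ a → a) ys   ≡⟨ map-id ys ⟩
      ys                 ∎

    g-returns : ∀ {a} → a ∈ map f u → a ∉ u → g a ∈ u
    g-returns {a} a∈v a∉u with g a ∈? u | g a ∈? map f u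
    ... | yes ga∈u | _ = ga∈u
    ... | no _ | yes ga∈v with ∈-map⁻ f ga∈v
    ...   | c , c∈u , ga≡fc =
            contradiction (subst (_∈ u) (g-injective (trans (agrees c∈u) (sym ga≡fc))) c∈u) a∉u
    g-returns {a} a∈v a∉u | no ga∉u | no ga∉v =
      contradiction (subst (_∈ map f u) (sym (g-injective (fixes ga∉u ga∉v))) a∈v) ga∉v

    -- Q lists exactly the letters of u and of map f u; g permutes them and fixes all others.
    Q : List A
    Q = map g⁻¹ u ++ u

    v⊆Q : ∀ {a} → a ∈ map f u → a ∈ Q
    v⊆Q {a} a∈v with a ∈? u
    ... | yes a∈u = ∈-++⁺ʳ _ a∈u
    ... | no a∉u  = ∈-++⁺ˡ (subst (_∈ map g⁻¹ u) (inverseʳ a) (∈-map⁺ g⁻¹ (g-returns a∈v a∉u)))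

    g-∈Q : ∀ {a} → a ∈ Q → g a ∈ Q
    g-∈Q a∈Q with ∈-++⁻ (map g⁻¹ u) a∈Q
    ... | inj₂ a∈u = v⊆Q (subst (_∈ map f u) (sym (agrees a∈u)) (∈-map⁺ f a∈u))
    ... | inj₁ a∈ with ∈-map⁻ g⁻¹ a∈
    ...   | c , c∈u , refl = ∈-++⁺ʳ _ (subst (_∈ u) (sym (inverseˡ c)) c∈u)

    g-∉Q : ∀ {a} → a ∉ Q → g a ≡ a
    g-∉Q a∉Q = fixes (a∉Q ∘ ∈-++⁺ʳ _) (a∉Q ∘ v⊆Q)

    g⁻¹-∈Q : ∀ {a} → a ∈ Q → g⁻¹ a ∈ Q
    g⁻¹-∈Q {a} a∈Q with g⁻¹ a ∈? Q
    ... | yes b∈Q = b∈Q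
    ... | no b∉Q  = contradiction (subst (_∈ Q) (trans (sym (inverseˡ a)) (g-∉Q b∉Q)) a∈Q) b∉Q

    π⟨_⟩ : List A → List A
    π⟨ ρ ⟩ = keepLast (ρ ++ map g⁻¹ (map g⁻¹ u) ++ map g⁻¹ u)

    keepLast-π⟨⟩-++ : ∀ ρ → keepLast (π⟨ ρ ⟩ ++ u) ≡ keepLast (map g π⟨ ρ ⟩)
    keepLast-π⟨⟩-++ ρ = begin
      keepLast (keepLast X ++ u)          ≡⟨ keepLast-++-congˡ (keepLast X) X u (keepLast-idem X) ⟩
      keepLast (X ++ u)                   ≡⟨ cong keepLast reassociate ⟩
      keepLast (ρ ++ G₂ ++ Q)             ≡⟨ keepLast-++-absorb ρ Q G₂⊆Q ⟩
      keepLast (ρ ++ Q)                   ≡⟨ keepLast-map-++ g-injective g-∈Q g-∉Q ρ ⟨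
      keepLast (map g ρ ++ Q)             ≡⟨ cong keepLast map-X ⟨
      keepLast (map g X)                  ≡⟨ keepLast-idem (map g X) ⟨
      keepLast (keepLast (map g X))       ≡⟨ cong keepLast (keepLast-map g-injective X) ⟩
      keepLast (map g (keepLast X))       ∎
      where
      G₁ G₂ X : List A
      G₁ = map g⁻¹ u
      G₂ = map g⁻¹ G₁
      X  = ρ ++ G₂ ++ G₁

      reassociate : X ++ u ≡ ρ ++ G₂ ++ Q
      reassociate = trans (++-assoc ρ (G₂ ++ G₁) u) (cong (ρ ++_) (++-assoc G₂ G₁ u))

      G₂⊆Q : ∀ {a} → a ∈ G₂ → a ∈ Q
      G₂⊆Q a∈ with ∈-map⁻ g⁻¹ a∈
      ... | b , b∈G₁ , refl = g⁻¹-∈Q (∈-++⁺ˡ b∈G₁)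

      map-X : map g X ≡ map g ρ ++ Q
      map-X = trans (map-++ g ρ (G₂ ++ G₁)) (cong (map g ρ ++_)
                (trans (map-++ g G₂ G₁) (cong₂ _++_ (map-inverseˡ G₁) (map-inverseˡ u))))

module _ {σ : ℕ} where

  open ListsWithDecEq (Fin._≟_ {n = σ})
  open DecMembership (Fin._≟_ {n = σ}) using (_∈?_)

  afterLast-∉ : ∀ a (x : Word σ) → a ∉ x → afterLast a x ≡ []
  afterLast-∉ a []      _  = refl
  afterLast-∉ a (b ∷ x) a∉ with a ∈? x
  ... | yes a∈x = contradiction (there a∈x) a∉
  ... | no _ with a Fin.≟ b
  ...   | yes a≡b = contradiction (here a≡b) a∉
  ...   | no _    = refl

  afterLast-keepLast : ∀ a (x : Word σ) → afterLast a (keepLast x) ≡ keepLast (afterLast a x)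
  afterLast-keepLast a []      = refl
  afterLast-keepLast a (c ∷ x) with c ∈? x
  afterLast-keepLast a (c ∷ x) | yes c∈x with a ∈? x
  ... | yes _  = afterLast-keepLast a x
  ... | no a∉x with a Fin.≟ c
  ...   | yes refl = contradiction c∈x a∉x
  ...   | no _     = afterLast-∉ a (keepLast x) (a∉x ∘ ∈-keepLast⁻ x)
  afterLast-keepLast a (c ∷ x) | no c∉x with a ∈? keepLast x | a ∈? x
  ... | yes _   | yes _   = afterLast-keepLast a x
  ... | yes a∈k | no a∉x  = contradiction (∈-keepLast⁻ x a∈k) a∉x
  ... | no a∉k  | yes a∈x = contradiction (∈-keepLast⁺ x a∈x) a∉k
  ... | no _    | no _ with a Fin.≟ c
  ...   | yes _ = refl
  ...   | no _  = refl

  afterLast-map : {g : Fin σ → Fin σ} → Injective _≡_ _≡_ g →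
                  ∀ a (x : Word σ) → afterLast (g a) (map g x) ≡ map g (afterLast a x)
  afterLast-map g-inj a []      = refl
  afterLast-map {g} g-inj a (b ∷ x) with g a ∈? map g x | a ∈? x
  ... | yes _   | yes _   = afterLast-map g-inj a x
  ... | yes ga∈ | no a∉x  = contradiction (∈-map⁻-injective g-inj x ga∈) a∉x
  ... | no ga∉  | yes a∈x = contradiction (∈-map⁺ g a∈x) ga∉
  ... | no _    | no _ with g a Fin.≟ g b | a Fin.≟ b
  ...   | yes _     | yes _   = refl
  ...   | no _      | no _    = refl
  ...   | yes ga≡gb | no a≢b  = contradiction (g-inj ga≡gb) a≢b
  ...   | no ga≢gb  | yes a≡b = contradiction (cong g a≡b) ga≢gb

  ind-keepLast : ∀ (x : Word σ) a → ind (keepLast x) a ≡ ind x a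
  ind-keepLast x a = trans (cong card (afterLast-keepLast a x))
    (card-cong (mk⇔ (∈-keepLast⁻ (afterLast a x)) (∈-keepLast⁺ (afterLast a x))))

  ind-map : {g : Fin σ → Fin σ} → Injective _≡_ _≡_ g → ∀ (x : Word σ) a → ind (map g x) (g a) ≡ ind x a
  ind-map g-inj x a = trans (cong card (afterLast-map g-inj a x)) (card-map g-inj (afterLast a x))

  hGo-++ : ∀ (x p q : Word σ) → hGo x (p ++ q) ≡ hGo x p ++ hGo (x ++ p) q
  hGo-++ x []      q = cong (λ y → hGo y q) (sym (++-identityʳ x))
  hGo-++ x (c ∷ p) q = cong (ind x c ∷_) (trans (hGo-++ (x ++ [ c ]) p q)
    (cong (λ y → hGo (x ++ [ c ]) p ++ hGo y q) (++-assoc x [ c ] p)))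

  hGo-cong : ∀ {x y : Word σ} → keepLast x ≡ keepLast y → ∀ p → hGo x p ≡ hGo y p
  hGo-cong eq [] = refl
  hGo-cong {x} {y} eq (c ∷ p) = cong₂ _∷_ ind-eq (hGo-cong (keepLast-++-congˡ x y [ c ] eq) p)
    where
    ind-eq : ind x c ≡ ind y c
    ind-eq = begin
      ind x c            ≡⟨ ind-keepLast x c ⟨
      ind (keepLast x) c ≡⟨ cong (λ s → ind s c) eq ⟩
      ind (keepLast y) c ≡⟨ ind-keepLast y c ⟩
      ind y c            ∎

  hGo-map : {g : Fin σ → Fin σ} → Injective _≡_ _≡_ g → ∀ (x p : Word σ) → hGo (map g x) (map g p) ≡ hGo x p
  hGo-map g-inj x []          = refl
  hGo-map {g} g-inj x (c ∷ p) = cong₂ _∷_ (ind-map g-inj x c)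
    (trans (cong (λ y → hGo y (map g p)) (sym (map-++ g x [ c ]))) (hGo-map g-inj (x ++ [ c ]) p))

lemma25 : (σ : ℕ) (w : Word σ) → IsParamSquare w →
          Σ (Word σ) λ π → IsPerm π × IsSquare (h π w)
lemma25 σ _ (u , _ , f , refl , _ , _ , f-injective , _ , refl) =
  π , π-perm , hGo π u , trans (hGo-++ π u (map f u)) (cong (hGo π u ++_) second-half)
  where
  open ListsWithDecEq (Fin._≟_ {n = σ})
  e : Extension f u
  e = extend f u f-injective
  open Extension e
  open ExtensionProperties e

  π : Word σ
  π = π⟨ allFin σ ⟩

  π-perm : IsPerm π
  π-perm a = count-keepLast _ (∈-++⁺ˡ (∈-allFin a))

  second-half : hGo (π ++ u) (map f u) ≡ hGo π u
  second-half = begin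
    hGo (π ++ u) (map f u)  ≡⟨ hGo-cong (keepLast-π⟨⟩-++ (allFin σ)) (map f u) ⟩
    hGo (map g π) (map f u) ≡⟨ cong (hGo (map g π)) (map-cong-local (All.tabulate agrees)) ⟨
    hGo (map g π) (map g u) ≡⟨ hGo-map g-injective π u ⟩
    hGo π u                 ∎
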